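{- Let $\mathcal{R}$ be a commutative ring with unity and $\mathcal{I}\subsetneq\mathcal{R}$ an ideal. Let $n>1$ and $(x_1,\ldots,x_n)\in\mathcal{R}^n$ with $\langle x_1\rangle+\cdots+\langle x_n\rangle+\mathcal{I}=\mathcal{R}$. Suppose there exist $a_1,\ldots,a_n\in\mathcal{R}$ with $\langle a_1\rangle+\cdots+\langle a_n\rangle=\mathcal{R}$ and $a_1x_1+\cdots+a_nx_n\in1+\mathcal{I}$. Then there exist $t_1,\ldots,t_n\in\mathcal{I}$ such that $\sum_{i=1}^n\langle x_i+t_i\rangle=\mathcal{R}$. -}

module Defs where

open import Level using (Level; _⊔_; suc)
open import Algebra.Bundles using (CommutativeRing)
open import Data.Nat using (ℕ)
open import Data.Fin using (Fin)
open import Data.Product using (Σ; ∃; _×_; _,_)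
open import Relation.Nullary using (¬_)

module _ {c ℓ : Level} (R : CommutativeRing c ℓ) where
  open CommutativeRing R

  record IsIdeal {p : Level} (I : Carrier → Set p) : Set (c ⊔ ℓ ⊔ p) where
    field
      resp-≈ : ∀ {x y} → x ≈ y → I x → I y
      0∈     : I 0#
      +-closed : ∀ {x y} → I x → I y → I (x + y)
      -closed  : ∀ {x} → I x → I (- x)
      *-closed : ∀ r {x} → I x → I (r * x)

  Proper : {p : Level} → (Carrier → Set p) → Set (c ⊔ p)
  Proper I = Σ Carrier λ y → ¬ I y

  ∑ : (n : ℕ) → (Fin n → Carrier) → Carrier
  ∑ ℕ.zero f = 0#
  ∑ (ℕ.suc n) f = f Fin.zero + ∑ n (λ i → f (Fin.suc i))

  InSumPrincipalPlus : {p : Level} (n : ℕ) → (Fin n → Carrier) → (Carrier → Set p) → Carrier → Set (c ⊔ ℓ ⊔ p)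
  InSumPrincipalPlus n x I y =
    Σ (Fin n → Carrier) λ r → Σ Carrier λ t → I t × (y ≈ ∑ n (λ i → r i * x i) + t)

  InSumPrincipal : (n : ℕ) → (Fin n → Carrier) → Carrier → Set (c ⊔ ℓ)
  InSumPrincipal n x y = Σ (Fin n → Carrier) λ r → y ≈ ∑ n (λ i → r i * x i)

  SumPrincipalPlusIsWhole : {p : Level} (n : ℕ) → (Fin n → Carrier) → (Carrier → Set p) → Set (c ⊔ ℓ ⊔ p)
  SumPrincipalPlusIsWhole n x I = ∀ y → InSumPrincipalPlus n x I y

  SumPrincipalIsWhole : (n : ℕ) → (Fin n → Carrier) → Set (c ⊔ ℓ)
  SumPrincipalIsWhole n x = ∀ y → InSumPrincipal n x y

{-# OPTIONS --safe #-}
-- If a unimodular row a pairs with x to 1 + s (s ∈ I), pick b with ∑ bᵢaᵢ = 1 and put tᵢ = -s bᵢ ∈ I.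
-- Then ∑ aᵢ(xᵢ + tᵢ) = (1 + s) - s = 1, so y = ∑ (y aᵢ)(xᵢ + tᵢ) for every y.
module Submission where

open import Defs
open import Level using (Level)
open import Algebra.Bundles using (CommutativeRing)
open import Data.Nat using (ℕ; zero; suc; _>_)
open import Data.Fin using (Fin)
open import Data.Product using (Σ; _×_; _,_)
open import Data.Vec.Functional using (Vector)
open import Relation.Binary.PropositionalEquality as ≡ using (_≡_)
import Algebra.Properties.CommutativeSemigroup as CommutativeSemigroupProperties
import Algebra.Properties.Group as GroupProperties
import Algebra.Properties.Semiring.Sum as SemiringSum
import Relation.Binary.Reasoning.Setoid as SetoidReasoning

module _ {c ℓ : Level} (R : CommutativeRing c ℓ) where
  open CommutativeRing R
  open SemiringSum semiring using (sum; sum-cong-≋; ∑-distrib-+; *-distribˡ-sum)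
  open CommutativeSemigroupProperties *-commutativeSemigroup using (x∙yz≈z∙yx)
  open SetoidReasoning setoid

  ∑≡sum : ∀ n (f : Vector Carrier n) → ∑ R n f ≡ sum f
  ∑≡sum zero    f = ≡.refl
  ∑≡sum (suc n) f = ≡.cong (f Fin.zero +_) (∑≡sum n (λ i → f (Fin.suc i)))

  unimodular⇒SumPrincipalIsWhole : ∀ {n} (a y : Vector Carrier n) →
    sum (λ i → a i * y i) ≈ 1# → SumPrincipalIsWhole R n y
  unimodular⇒SumPrincipalIsWhole {n} a y ∑ay≈1 z = (λ i → z * a i) , (begin
    z                                ≈⟨ *-identityʳ z ⟨
    z * 1#                           ≈⟨ *-congˡ ∑ay≈1 ⟨
    z * sum (λ i → a i * y i)        ≈⟨ *-distribˡ-sum z (λ i → a i * y i) ⟩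
    sum (λ i → z * (a i * y i))      ≈⟨ sum-cong-≋ (λ i → *-assoc z (a i) (y i)) ⟨
    sum (λ i → z * a i * y i)        ≡⟨ ∑≡sum n _ ⟨
    ∑ R n (λ i → z * a i * y i)      ∎)

  sum-shift-by-inverse : ∀ {n} (a b x : Vector Carrier n) r →
    sum (λ i → b i * a i) ≈ 1# →
    sum (λ i → a i * (x i + b i * r)) ≈ sum (λ i → a i * x i) + r
  sum-shift-by-inverse a b x r ∑ba≈1 = begin
    sum (λ i → a i * (x i + b i * r))
      ≈⟨ sum-cong-≋ (λ i → distribˡ (a i) (x i) (b i * r)) ⟩
    sum (λ i → a i * x i + a i * (b i * r))
      ≈⟨ ∑-distrib-+ (λ i → a i * x i) (λ i → a i * (b i * r)) ⟩
    sum (λ i → a i * x i) + sum (λ i → a i * (b i * r))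
      ≈⟨ +-congˡ (sum-cong-≋ (λ i → x∙yz≈z∙yx (a i) (b i) r)) ⟩
    sum (λ i → a i * x i) + sum (λ i → r * (b i * a i))
      ≈⟨ +-congˡ (*-distribˡ-sum r (λ i → b i * a i)) ⟨
    sum (λ i → a i * x i) + r * sum (λ i → b i * a i)
      ≈⟨ +-congˡ (*-congˡ ∑ba≈1) ⟩
    sum (λ i → a i * x i) + r * 1#
      ≈⟨ +-congˡ (*-identityʳ r) ⟩
    sum (λ i → a i * x i) + r
      ∎

  module _ {p : Level} {I : Carrier → Set p} (isIdeal : IsIdeal R I) where
    open IsIdeal isIdeal
    open GroupProperties +-group using (//-rightDividesʳ)

    unimodular-lift : ∀ {n} (a b x : Vector Carrier n) {s} → I s →
      1# ≈ ∑ R n (λ i → b i * a i) → ∑ R n (λ i → a i * x i) ≈ 1# + s →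
      Σ (Vector Carrier n) λ t → (∀ i → I (t i)) × SumPrincipalIsWhole R n (λ i → x i + t i)
    unimodular-lift {n} a b x {s} s∈I 1≈∑ba ∑ax≈1+s =
      t , t∈I , unimodular⇒SumPrincipalIsWhole a (λ i → x i + t i) ∑a[x+t]≈1
      where
      t : Vector Carrier n
      t i = b i * - s

      t∈I : ∀ i → I (t i)
      t∈I i = *-closed (b i) (-closed s∈I)

      ∑a[x+t]≈1 : sum (λ i → a i * (x i + t i)) ≈ 1#
      ∑a[x+t]≈1 = begin
        sum (λ i → a i * (x i + t i))  ≈⟨ sum-shift-by-inverse a b x (- s) ∑ba≈1 ⟩
        sum (λ i → a i * x i) + - s    ≡⟨ ≡.cong (_+ - s) (∑≡sum n _) ⟨
        ∑ R n (λ i → a i * x i) + - s  ≈⟨ +-congʳ ∑ax≈1+s ⟩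
        1# + s + - s                   ≈⟨ //-rightDividesʳ s 1# ⟩
        1#                             ∎
        where
        ∑ba≈1 : sum (λ i → b i * a i) ≈ 1#
        ∑ba≈1 = sym (trans 1≈∑ba (reflexive (∑≡sum n _)))

mainTheorem20 : {c ℓ p : Level} (R : CommutativeRing c ℓ) → let open CommutativeRing R in
    (I : Carrier → Set p) → IsIdeal R I → Proper R I →
    (n : ℕ) → n > 1 → (x : Fin n → Carrier) →
    SumPrincipalPlusIsWhole R n x I →
    (Σ (Fin n → Carrier) λ a → SumPrincipalIsWhole R n a × Σ Carrier λ s → I s × (∑ R n (λ i → a i * x i) ≈ 1# + s)) →
    Σ (Fin n → Carrier) λ t → (∀ i → I (t i)) × SumPrincipalIsWhole R n (λ i → x i + t i)
mainTheorem20 R I isIdeal _ n _ x _ (a , a-whole , s , s∈I , ∑ax≈1+s) =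
  let (b , 1≈∑ba) = a-whole (CommutativeRing.1# R)
  in unimodular-lift R isIdeal a b x s∈I 1≈∑ba ∑ax≈1+s
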